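{- Let $G=(V,A)$ be an $n$-vertex DAG and $\gamma$ a topological ordering of its vertices. If $x$ is an extreme point of $P(G,\gamma)$, then $x\in\mathbb{Z}^n$.
   Context: A topological ordering of an $n$-vertex DAG $G=(V,A)$ is a bijection $\gamma:V\to[n]$ with $\gamma(u)<\gamma(v)$ for every arc $(v,u)\in A$. The polyhedron $P(G,\gamma)\subseteq\mathbb{R}^n$ is the set of $x$ satisfying: $x_{\gamma(u)}\le x_{\gamma(v)}$ for all $(v,u)\in A$; $x_{\gamma(v)}\le x_{\gamma(u)}-1$ for all $u,v$ with $(v,u)\notin A$ and $\gamma(u)<\gamma(v)$; and $x_i\ge1$ for all $i\in[n]$.
   Formalization: The polyhedron $P(G,\gamma)$ is taken over ℚ^n rather than ℝ^n, so the extreme point x and the points and weights in the convex combinations testing extremality are rational. -}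

module Defs where

open import Data.Nat using (ℕ)
open import Data.Fin as Fin using (Fin)
open import Data.Integer using (ℤ)
open import Data.Rational using (ℚ; _≤_; _<_; _+_; _*_; _-_; _/_; 0ℚ; 1ℚ)
open import Data.Product using (_×_; ∃)
open import Relation.Nullary using (¬_)
open import Relation.Binary.PropositionalEquality using (_≡_)
open import Function.Definitions using (Bijective)

-- A directed graph on vertex set V = Fin n; A v u means the arc (v,u) ∈ A.
Digraph : ℕ → Set₁
Digraph n = Fin n → Fin n → Set

data Path {n : ℕ} (A : Digraph n) : Fin n → Fin n → Set where
  edge : ∀ {v w} → A v w → Path A v w
  _∷_  : ∀ {v u w} → A v u → Path A u w → Path A v w

IsDAG : {n : ℕ} → Digraph n → Set
IsDAG A = ∀ v → ¬ Path A v v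

-- Topological ordering γ : V → [n] (here [n] = Fin n, 0-based):
-- a bijection with γ(u) < γ(v) for every arc (v,u).
IsTopologicalOrdering : {n : ℕ} → Digraph n → (Fin n → Fin n) → Set
IsTopologicalOrdering A γ = Bijective _≡_ _≡_ γ × (∀ u v → A v u → γ u Fin.< γ v)

Point : ℕ → Set
Point n = Fin n → ℚ

InP : {n : ℕ} → Digraph n → (Fin n → Fin n) → Point n → Set
InP A γ x =
  (∀ u v → A v u → x (γ u) ≤ x (γ v)) ×
  (∀ u v → ¬ A v u → γ u Fin.< γ v → x (γ v) ≤ x (γ u) - 1ℚ) ×
  (∀ i → 1ℚ ≤ x i)

IsExtremePoint : {n : ℕ} → (Point n → Set) → Point n → Set
IsExtremePoint S x =
  S x ×
  (∀ y z (λ' : ℚ) → S y → S z → 0ℚ < λ' → λ' < 1ℚ →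
     (∀ i → x i ≡ λ' * y i + (1ℚ - λ') * z i) →
     ∀ i → y i ≡ z i)

IsIntegral : {n : ℕ} → Point n → Set
IsIntegral x = ∀ i → ∃ λ (k : ℤ) → x i ≡ k / 1

module Submission where

-- P(G,γ) is cut out by constraints x_a ≤ x_b + c with c ∈ ℤ and x_i ≥ 1, so applying coordinatewise
-- any monotone f : ℚ → ℚ with f (p − 1) = f p − 1 and f ≥ 1 on [1,∞) maps it into itself. Two such maps are p ↦ ⌊p⌋ + {p}² and p ↦ ⌊p⌋ + 1 − (1 − {p})². They average
-- to the identity and differ wherever {p} ≠ 0, so at an extreme point x, the midpoint of its two
-- images, every coordinate is an integer.

open import Defs
open import Data.Nat using (ℕ)
open import Data.Fin using (Fin)

import Data.Nat as ℕ
import Data.Nat.Coprimality as Coprimality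
open import Data.Integer as ℤ using (ℤ; +_; -[1+_])
import Data.Integer.Properties as ℤP
open import Data.Integer.DivMod using (div-pos-is-/ℕ; [n/d]*d≤n; n<s[n/ℕd]*d)
open import Data.Rational
  using (ℚ; mkℚ; _/_; 0ℚ; 1ℚ; ½; _+_; _*_; _-_; -_; floor; *≤*; *<*; _≤_; _<_; nonNegative; positive)
import Data.Rational.Properties as ℚP
open import Algebra.Properties.Group ℚP.+-0-group using (∙-cancelˡ)
open import Data.Rational.Solver using (module +-*-Solver)
open +-*-Solver using (solve; _:=_; _:+_; _:*_; _:-_; con)
open import Data.Product using (_,_; ∃)
open import Relation.Nullary using (yes; no)
open import Data.Empty using (⊥-elim)
open import Function using (_∘_)
open import Relation.Binary.Definitions using (tri<; tri≈; tri>)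
open import Relation.Binary.PropositionalEquality

p≤q⇒0≤q-p : ∀ {p q} → p ≤ q → 0ℚ ≤ q - p
p≤q⇒0≤q-p {p} {q} p≤q = subst (_≤ q - p) (ℚP.+-inverseʳ p) (ℚP.+-monoˡ-≤ (- p) p≤q)

sub-antimonoʳ-≤ : ∀ r {p q} → p ≤ q → r - q ≤ r - p
sub-antimonoʳ-≤ r p≤q = ℚP.+-monoʳ-≤ r (ℚP.neg-antimono-≤ p≤q)

-- k / 1 built in normal form, so that its numerator and denominator reduce.
fromℤ : ℤ → ℚ
fromℤ k = mkℚ k 0 (Coprimality.sym (Coprimality.1-coprimeTo ℤ.∣ k ∣))

fromℤ≡/1 : ∀ k → fromℤ k ≡ k / 1
fromℤ≡/1 k = sym (ℚP.↥p/↧p≡p (fromℤ k))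

fromℤ-+ : ∀ k m → fromℤ (k ℤ.+ m) ≡ fromℤ k + fromℤ m
fromℤ-+ k m = trans (fromℤ≡/1 (k ℤ.+ m))
  (cong₂ (λ a b → (a ℤ.+ b) / 1) (sym (ℤP.*-identityʳ k)) (sym (ℤP.*-identityʳ m)))

fromℤ-suc : ∀ k → fromℤ (ℤ.suc k) ≡ 1ℚ + fromℤ k
fromℤ-suc = fromℤ-+ (+ 1)

fromℤ-pred : ∀ k → fromℤ (ℤ.pred k) ≡ - 1ℚ + fromℤ k
fromℤ-pred = fromℤ-+ -[1+ 0 ]

fromℤ-mono-≤ : ∀ {k m} → k ℤ.≤ m → fromℤ k ≤ fromℤ m
fromℤ-mono-≤ {k} {m} k≤m = *≤* (subst₂ ℤ._≤_ (sym (ℤP.*-identityʳ k)) (sym (ℤP.*-identityʳ m)) k≤m)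

fromℤ-cancel-< : ∀ {k m} → fromℤ k < fromℤ m → k ℤ.< m
fromℤ-cancel-< {k} {m} (*<* k<m) = subst₂ ℤ._<_ (ℤP.*-identityʳ k) (ℤP.*-identityʳ m) k<m

⌊p⌋≤p : ∀ p → fromℤ ⌊ p ⌋ ≤ p
⌊p⌋≤p p@(mkℚ n d _) =
  *≤* (subst (⌊ p ⌋ ℤ.* + ℕ.suc d ℤ.≤_) (sym (ℤP.*-identityʳ n)) ([n/d]*d≤n n (+ ℕ.suc d)))

p<1+⌊p⌋ : ∀ p → p < fromℤ (ℤ.suc ⌊ p ⌋)
p<1+⌊p⌋ p@(mkℚ n d _) = *<* (subst₂ ℤ._<_ (sym (ℤP.*-identityʳ n))
  (cong (λ q → ℤ.suc q ℤ.* + ℕ.suc d) (sym (div-pos-is-/ℕ n (ℕ.suc d))))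
  (n<s[n/ℕd]*d n (ℕ.suc d)))

i<1+j⇒i≤j : ∀ {i j} → i ℤ.< ℤ.suc j → i ℤ.≤ j
i<1+j⇒i≤j {i} {j} i<1+j = subst (i ℤ.≤_) (ℤP.pred-suc j) (ℤP.i<j⇒i≤pred[j] i<1+j)

k≤p⇒k≤⌊p⌋ : ∀ {k p} → fromℤ k ≤ p → k ℤ.≤ ⌊ p ⌋
k≤p⇒k≤⌊p⌋ {p = p} k≤p = i<1+j⇒i≤j (fromℤ-cancel-< (ℚP.≤-<-trans k≤p (p<1+⌊p⌋ p)))

⌊⌋-mono-≤ : ∀ {p q} → p ≤ q → ⌊ p ⌋ ℤ.≤ ⌊ q ⌋
⌊⌋-mono-≤ {p} p≤q = k≤p⇒k≤⌊p⌋ (ℚP.≤-trans (⌊p⌋≤p p) p≤q)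

⌊p-1⌋≡⌊p⌋-1 : ∀ p → ⌊ p - 1ℚ ⌋ ≡ ℤ.pred ⌊ p ⌋
⌊p-1⌋≡⌊p⌋-1 p = ℤP.≤-antisym upper lower
  where
  open ℚP.≤-Reasoning
  lower : ℤ.pred ⌊ p ⌋ ℤ.≤ ⌊ p - 1ℚ ⌋
  lower = k≤p⇒k≤⌊p⌋ (begin
    fromℤ (ℤ.pred ⌊ p ⌋)  ≡⟨ fromℤ-pred ⌊ p ⌋ ⟩
    - 1ℚ + fromℤ ⌊ p ⌋    ≤⟨ ℚP.+-monoʳ-≤ (- 1ℚ) (⌊p⌋≤p p) ⟩
    - 1ℚ + p              ≡⟨ ℚP.+-comm (- 1ℚ) p ⟩
    p - 1ℚ                ∎)
  upper : ⌊ p - 1ℚ ⌋ ℤ.≤ ℤ.pred ⌊ p ⌋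
  upper = subst (ℤ._≤ ℤ.pred ⌊ p ⌋) (ℤP.pred-suc ⌊ p - 1ℚ ⌋) (ℤP.pred-mono (k≤p⇒k≤⌊p⌋ (begin
    fromℤ (ℤ.suc ⌊ p - 1ℚ ⌋)  ≡⟨ fromℤ-suc ⌊ p - 1ℚ ⌋ ⟩
    1ℚ + fromℤ ⌊ p - 1ℚ ⌋     ≤⟨ ℚP.+-monoʳ-≤ 1ℚ (⌊p⌋≤p (p - 1ℚ)) ⟩
    1ℚ + (p - 1ℚ)             ≡⟨ solve 1 (λ p → con 1ℚ :+ (p :- con 1ℚ) := p) refl p ⟩
    p                         ∎)))

-- Not the library's fracPart, which is ∣p − truncate p∣ and so differs for negative p.
frac : ℚ → ℚ
frac p = p - fromℤ ⌊ p ⌋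

0≤frac : ∀ p → 0ℚ ≤ frac p
0≤frac p = subst (_≤ frac p) (ℚP.+-inverseʳ (fromℤ ⌊ p ⌋)) (ℚP.+-monoˡ-≤ (- fromℤ ⌊ p ⌋) (⌊p⌋≤p p))

frac<1 : ∀ p → frac p < 1ℚ
frac<1 p = begin-strict
  p - K                    <⟨ ℚP.+-monoˡ-< (- K) (p<1+⌊p⌋ p) ⟩
  fromℤ (ℤ.suc ⌊ p ⌋) - K  ≡⟨ cong (_- K) (fromℤ-suc ⌊ p ⌋) ⟩
  1ℚ + K - K               ≡⟨ solve 1 (λ K → con 1ℚ :+ K :- K := con 1ℚ) refl K ⟩
  1ℚ                       ∎
  where
  open ℚP.≤-Reasoning
  K = fromℤ ⌊ p ⌋

frac≤1 : ∀ p → frac p ≤ 1ℚ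
frac≤1 p = ℚP.<⇒≤ (frac<1 p)

frac[p-1]≡frac : ∀ p → frac (p - 1ℚ) ≡ frac p
frac[p-1]≡frac p = begin
  p - 1ℚ - fromℤ ⌊ p - 1ℚ ⌋          ≡⟨ cong (λ k → p - 1ℚ - fromℤ k) (⌊p-1⌋≡⌊p⌋-1 p) ⟩
  p - 1ℚ - fromℤ (ℤ.pred ⌊ p ⌋)      ≡⟨ cong (λ q → p - 1ℚ - q) (fromℤ-pred ⌊ p ⌋) ⟩
  p - 1ℚ - (- 1ℚ + fromℤ ⌊ p ⌋)
    ≡⟨ solve 2 (λ p K → p :- con 1ℚ :- (con (- 1ℚ) :+ K) := p :- K) refl p (fromℤ ⌊ p ⌋) ⟩
  p - fromℤ ⌊ p ⌋                    ∎
  where open ≡-Reasoning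

p≡⌊p⌋+frac : ∀ p → p ≡ fromℤ ⌊ p ⌋ + frac p
p≡⌊p⌋+frac p = solve 2 (λ p K → p := K :+ (p :- K)) refl p (fromℤ ⌊ p ⌋)

record Profile (ψ : ℚ → ℚ) : Set where
  field
    monotone : ∀ {g h} → 0ℚ ≤ g → g ≤ h → h ≤ 1ℚ → ψ g ≤ ψ h
    0≤ψ[0]   : 0ℚ ≤ ψ 0ℚ
    ψ[1]≤1   : ψ 1ℚ ≤ 1ℚ

  0≤ψ : ∀ {g} → 0ℚ ≤ g → g ≤ 1ℚ → 0ℚ ≤ ψ g
  0≤ψ 0≤g g≤1 = ℚP.≤-trans 0≤ψ[0] (monotone ℚP.≤-refl 0≤g g≤1)

  ψ≤1 : ∀ {g} → 0ℚ ≤ g → g ≤ 1ℚ → ψ g ≤ 1ℚ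
  ψ≤1 0≤g g≤1 = ℚP.≤-trans (monotone 0≤g g≤1 ℚP.≤-refl) ψ[1]≤1

square : ℚ → ℚ
square g = g * g

square-mono-≤ : ∀ {g h} → 0ℚ ≤ g → g ≤ h → square g ≤ square h
square-mono-≤ {g} {h} 0≤g g≤h = ℚP.≤-trans (ℚP.*-monoˡ-≤-nonNeg g {{nonNegative 0≤g}} g≤h)
  (ℚP.*-monoʳ-≤-nonNeg h {{nonNegative (ℚP.≤-trans 0≤g g≤h)}} g≤h)

square<id : ∀ {g} → 0ℚ < g → g < 1ℚ → square g < g
square<id {g} 0<g g<1 = subst (square g <_) (ℚP.*-identityʳ g) (ℚP.*-monoʳ-<-pos g {{positive 0<g}} g<1)

square-profile : Profile square
square-profile = record
  { monotone = λ 0≤g g≤h _ → square-mono-≤ 0≤g g≤h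
  ; 0≤ψ[0]   = ℚP.≤-refl
  ; ψ[1]≤1   = ℚP.≤-refl
  }

reflect : (ℚ → ℚ) → ℚ → ℚ
reflect ψ g = 1ℚ - ψ (1ℚ - g)

reflect-profile : ∀ {ψ} → Profile ψ → Profile (reflect ψ)
reflect-profile P = record
  { monotone = λ {g} {h} 0≤g g≤h h≤1 → sub-antimonoʳ-≤ 1ℚ
      (monotone (p≤q⇒0≤q-p h≤1) (sub-antimonoʳ-≤ 1ℚ g≤h) (sub-antimonoʳ-≤ 1ℚ 0≤g))
  ; 0≤ψ[0]   = p≤q⇒0≤q-p ψ[1]≤1
  ; ψ[1]≤1   = sub-antimonoʳ-≤ 1ℚ 0≤ψ[0]
  }
  where open Profile P

extend : (ℚ → ℚ) → ℚ → ℚ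
extend ψ p = fromℤ ⌊ p ⌋ + ψ (frac p)

module _ {ψ : ℚ → ℚ} (P : Profile ψ) where
  open Profile P

  ⌊p⌋≤extend : ∀ p → fromℤ ⌊ p ⌋ ≤ extend ψ p
  ⌊p⌋≤extend p = subst (_≤ extend ψ p) (ℚP.+-identityʳ (fromℤ ⌊ p ⌋))
    (ℚP.+-monoʳ-≤ (fromℤ ⌊ p ⌋) (0≤ψ (0≤frac p) (frac≤1 p)))

  extend≤1+⌊p⌋ : ∀ p → extend ψ p ≤ fromℤ (ℤ.suc ⌊ p ⌋)
  extend≤1+⌊p⌋ p = subst (extend ψ p ≤_) (trans (ℚP.+-comm (fromℤ ⌊ p ⌋) 1ℚ) (sym (fromℤ-suc ⌊ p ⌋)))
    (ℚP.+-monoʳ-≤ (fromℤ ⌊ p ⌋) (ψ≤1 (0≤frac p) (frac≤1 p)))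

  extend-mono-≤ : ∀ {p q} → p ≤ q → extend ψ p ≤ extend ψ q
  extend-mono-≤ {p} {q} p≤q with ⌊ p ⌋ ℤ.≟ ⌊ q ⌋
  ... | no ⌊p⌋≢⌊q⌋ = begin
    extend ψ p               ≤⟨ extend≤1+⌊p⌋ p ⟩
    fromℤ (ℤ.suc ⌊ p ⌋)      ≤⟨ fromℤ-mono-≤ (ℤP.i<j⇒suc[i]≤j (ℤP.≤∧≢⇒< (⌊⌋-mono-≤ p≤q) ⌊p⌋≢⌊q⌋)) ⟩
    fromℤ ⌊ q ⌋              ≤⟨ ⌊p⌋≤extend q ⟩
    extend ψ q               ∎
    where open ℚP.≤-Reasoning
  ... | yes ⌊p⌋≡⌊q⌋ = subst (λ k → extend ψ p ≤ fromℤ k + ψ (frac q)) ⌊p⌋≡⌊q⌋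
    (ℚP.+-monoʳ-≤ (fromℤ ⌊ p ⌋) (monotone (0≤frac p) frac-p≤frac-q (frac≤1 q)))
    where
    frac-p≤frac-q : frac p ≤ frac q
    frac-p≤frac-q = subst (λ k → frac p ≤ q - fromℤ k) ⌊p⌋≡⌊q⌋ (ℚP.+-monoˡ-≤ (- fromℤ ⌊ p ⌋) p≤q)

  extend[p-1]≡extend[p]-1 : ∀ p → extend ψ (p - 1ℚ) ≡ extend ψ p - 1ℚ
  extend[p-1]≡extend[p]-1 p = begin
    fromℤ ⌊ p - 1ℚ ⌋ + ψ (frac (p - 1ℚ))
      ≡⟨ cong₂ _+_ (cong fromℤ (⌊p-1⌋≡⌊p⌋-1 p)) (cong ψ (frac[p-1]≡frac p)) ⟩
    fromℤ (ℤ.pred ⌊ p ⌋) + ψ (frac p)       ≡⟨ cong (_+ ψ (frac p)) (fromℤ-pred ⌊ p ⌋) ⟩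
    - 1ℚ + fromℤ ⌊ p ⌋ + ψ (frac p)
      ≡⟨ solve 2 (λ K y → con (- 1ℚ) :+ K :+ y := K :+ y :- con 1ℚ) refl (fromℤ ⌊ p ⌋) (ψ (frac p)) ⟩
    fromℤ ⌊ p ⌋ + ψ (frac p) - 1ℚ           ∎
    where open ≡-Reasoning

  1≤extend : ∀ {p} → 1ℚ ≤ p → 1ℚ ≤ extend ψ p
  1≤extend {p} 1≤p = ℚP.≤-trans (fromℤ-mono-≤ (k≤p⇒k≤⌊p⌋ 1≤p)) (⌊p⌋≤extend p)

record IsUnitShiftMonotone (f : ℚ → ℚ) : Set where
  field
    mono-≤        : ∀ {p q} → p ≤ q → f p ≤ f q
    f[p-1]≡f[p]-1 : ∀ p → f (p - 1ℚ) ≡ f p - 1ℚ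
    1≤f           : ∀ {p} → 1ℚ ≤ p → 1ℚ ≤ f p

extend-isUnitShiftMonotone : ∀ {ψ} → Profile ψ → IsUnitShiftMonotone (extend ψ)
extend-isUnitShiftMonotone P = record
  { mono-≤        = extend-mono-≤ P
  ; f[p-1]≡f[p]-1 = extend[p-1]≡extend[p]-1 P
  ; 1≤f           = 1≤extend P
  }

InP-map : ∀ {n} {A : Digraph n} {γ f} → IsUnitShiftMonotone f →
          ∀ {x} → InP A γ x → InP A γ (f ∘ x)
InP-map {γ = γ} {f} F {x} (arc , non-arc , ≥1) =
  (λ u v a → mono-≤ (arc u v a)) ,
  (λ u v ¬a γu<γv → subst (f (x (γ v)) ≤_) (f[p-1]≡f[p]-1 (x (γ u))) (mono-≤ (non-arc u v ¬a γu<γv))) ,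
  (λ i → 1≤f (≥1 i))
  where open IsUnitShiftMonotone F

square<reflect-square : ∀ {g} → 0ℚ < g → g < 1ℚ → square g < reflect square g
square<reflect-square {g} 0<g g<1 = ℚP.<-trans (square<id 0<g g<1) (begin-strict
  g                       ≡⟨ solve 1 (λ g → g := con 1ℚ :- (con 1ℚ :- g)) refl g ⟩
  1ℚ - (1ℚ - g)           <⟨ ℚP.+-monoʳ-< 1ℚ (ℚP.neg-antimono-< (square<id 0<1-g 1-g<1)) ⟩
  1ℚ - square (1ℚ - g)    ∎)
  where
  open ℚP.≤-Reasoning
  0<1-g : 0ℚ < 1ℚ - g
  0<1-g = subst (_< 1ℚ - g) (ℚP.+-inverseʳ g) (ℚP.+-monoˡ-< (- g) g<1)
  1-g<1 : 1ℚ - g < 1ℚ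
  1-g<1 = ℚP.+-monoʳ-< 1ℚ (ℚP.neg-antimono-< 0<g)

-- Since square g + reflect square g = 2 g, the two extensions average to the identity.
extend-midpoint : ∀ p → p ≡ ½ * extend (reflect square) p + (1ℚ - ½) * extend square p
extend-midpoint p = solve 2 (λ p K →
    p := con ½ :* (K :+ (con 1ℚ :- (con 1ℚ :- (p :- K)) :* (con 1ℚ :- (p :- K))))
           :+ (con 1ℚ :- con ½) :* (K :+ (p :- K) :* (p :- K)))
  refl p (fromℤ ⌊ p ⌋)

extend-agree⇒integral : ∀ p → extend (reflect square) p ≡ extend square p → ∃ λ (k : ℤ) → p ≡ k / 1
extend-agree⇒integral p agree with ℚP.<-cmp 0ℚ (frac p)
... | tri< 0<frac _ _ = ⊥-elim (ℚP.<-irrefl (sym (∙-cancelˡ (fromℤ ⌊ p ⌋) _ _ agree))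
                          (square<reflect-square 0<frac (frac<1 p)))
... | tri≈ _ 0≡frac _ = ⌊ p ⌋ , (begin
  p                        ≡⟨ p≡⌊p⌋+frac p ⟩
  fromℤ ⌊ p ⌋ + frac p     ≡⟨ cong (λ g → fromℤ ⌊ p ⌋ + g) (sym 0≡frac) ⟩
  fromℤ ⌊ p ⌋ + 0ℚ         ≡⟨ ℚP.+-identityʳ (fromℤ ⌊ p ⌋) ⟩
  fromℤ ⌊ p ⌋              ≡⟨ fromℤ≡/1 ⌊ p ⌋ ⟩
  ⌊ p ⌋ / 1                ∎)
  where open ≡-Reasoning
... | tri> _ _ frac<0 = ⊥-elim (ℚP.<-irrefl refl (ℚP.≤-<-trans (0≤frac p) frac<0))

lemma7 : (n : ℕ) (A : Digraph n) (γ : Fin n → Fin n) →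
         IsDAG A → IsTopologicalOrdering A γ →
         (x : Point n) → IsExtremePoint (InP A γ) x → IsIntegral x
lemma7 n A γ _ _ x (x∈P , extreme) i =
  extend-agree⇒integral (x i) (extreme upper lower ½ (InP-map upper-map x∈P) (InP-map lower-map x∈P)
                                 0<½ ½<1 (λ j → extend-midpoint (x j)) i)
  where
  upper-map : IsUnitShiftMonotone (extend (reflect square))
  upper-map = extend-isUnitShiftMonotone (reflect-profile square-profile)
  lower-map : IsUnitShiftMonotone (extend square)
  lower-map = extend-isUnitShiftMonotone square-profile
  upper lower : Point n
  upper = extend (reflect square) ∘ x
  lower = extend square ∘ x
  0<½ : 0ℚ < ½
  0<½ = *<* (ℤ.+<+ (ℕ.s≤s ℕ.z≤n))
  ½<1 : ½ < 1ℚ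
  ½<1 = *<* (ℤ.+<+ (ℕ.s≤s (ℕ.s≤s ℕ.z≤n)))
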